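{- Let $G$ be a finite abelian group with $r(G)\geq 2$ that is not isomorphic to $C_2\oplus C_{2m}$ for any positive integer $m$. Let $S$ be a sequence over $G$ of length $\mathsf{D}(G)+1$. If every nonempty zero-sum subsequence of $S$ has length at least $\mathsf{D}(G)-1$, then the subgroup $\langle S\rangle$ has rank at least $2$.
   Context: Groups are finite abelian, written additively; $r(H)$ is the rank of $H$ (minimal number of generators, i.e. the number of factors in $H\cong C_{n_1}\oplus\cdots\oplus C_{n_r}$, $1<n_1\mid\cdots\mid n_r$). A sequence over $G$ is a finite unordered sequence (multiset) of elements of $G$; length counts multiplicity; zero-sum means the terms sum to $0$. $\langle S\rangle$ is the subgroup generated by the elements occurring in $S$. $\mathsf{D}(G)$ is the smallest $t$ such that every sequence over $G$ of length at least $t$ has a nonempty zero-sum subsequence. -}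

module Defs where

open import Data.Nat using (ℕ; zero; suc; _+_; _*_; _∸_; _≤_; _<_)
open import Data.Nat.Divisibility using (_∣_)
open import Data.Fin using (Fin) renaming (_≤_ to _≤ᶠ_)
open import Data.List using (List; []; _∷_; length; lookup)
open import Data.List.Relation.Binary.Sublist.Propositional using (_⊆_)
open import Data.Product using (Σ; _×_; ∃; ∃₂)
open import Relation.Binary.PropositionalEquality using (_≡_)
open import Relation.Nullary using (¬_)
open import Function.Bundles using (_⇔_)

Cong : ℕ → ℕ → ℕ → Set
Cong m x y = ∃₂ λ a b → x + a * m ≡ y + b * m

-- A finite abelian group in invariant-factor form
--   G = C_{n 0} ⊕ ... ⊕ C_{n (r-1)},  1 < n 0 ∣ n 1 ∣ ... ∣ n (r-1).
record InvFactors (r : ℕ) : Set where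
  field
    n     : Fin r → ℕ
    n>1   : ∀ i → 1 < n i
    chain : ∀ i j → i ≤ᶠ j → n i ∣ n j

module Group {r : ℕ} (F : InvFactors r) where
  open InvFactors F

  -- an element of G, given by representatives of its coordinates
  Elem : Set
  Elem = Fin r → ℕ

  _≈_ : Elem → Elem → Set
  x ≈ y = ∀ i → Cong (n i) (x i) (y i)

  0G : Elem
  0G _ = 0

  _⊕_ : Elem → Elem → Elem
  (x ⊕ y) i = x i + y i

  _·_ : ℕ → Elem → Elem
  (k · x) i = k * x i

  Seq : Set
  Seq = List Elem

  σ : Seq → Elem
  σ []      = 0G
  σ (x ∷ S) = x ⊕ σ S

  ZeroSum : Seq → Set
  ZeroSum S = σ S ≈ 0G

  HasNZS : Seq → Set
  HasNZS S = ∃ λ T → T ⊆ S × 1 ≤ length T × ZeroSum T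

  DavProp : ℕ → Set
  DavProp t = ∀ (S : Seq) → t ≤ length S → HasNZS S

  IsDavenport : ℕ → Set
  IsDavenport d = DavProp d × (∀ t → DavProp t → d ≤ t)

  -- linear combination Σ c_j L_j (ℕ-coefficients suffice in a finite group)
  lin : (L : Seq) → (Fin (length L) → ℕ) → Elem
  lin []      c = 0G
  lin (x ∷ L) c = (c Fin.zero · x) ⊕ lin L (λ j → c (Fin.suc j))
    where import Data.Fin as Fin

  _∈⟨_⟩ : Elem → Seq → Set
  x ∈⟨ L ⟩ = ∃ λ (c : Fin (length L) → ℕ) → x ≈ lin L c

  SameSpan : Seq → Seq → Set
  SameSpan L S = ∀ x → (x ∈⟨ L ⟩) ⇔ (x ∈⟨ S ⟩)

  -- r(⟨S⟩) ≥ 2 : ⟨S⟩ is not generated by at most one element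
  RankAtLeast2 : Seq → Set
  RankAtLeast2 S = ¬ (∃ λ (L : Seq) → length L ≤ 1 × SameSpan L S)

-- G ≅ C_2 ⊕ C_{2m} for some m ≥ 1, read off the (unique) invariant factors:
-- r = 2 and the first invariant factor equals 2.
open import Data.Fin using (toℕ)
IsC2⊕C2m : {r : ℕ} → InvFactors r → Set
IsC2⊕C2m {r} F = r ≡ 2 × ∃ λ (i : Fin r) → toℕ i ≡ 0 × InvFactors.n F i ≡ 2

{-# OPTIONS --safe #-}
-- If ⟨S⟩ were generated by a single g, every prefix sum of S would be a
-- multiple c·g. As N = n_{r-1} annihilates G, two of the N + 1 prefix sums of
-- the first i ≤ N terms whose multipliers agree mod N coincide, and the block of
-- S between them is a nonempty zero-sum subsequence of length ≤ N. Unless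
-- G ≅ C₂ ⊕ C₂ₘ, the zero-sum free sequence e₀^(n₀−1) e₁^(n₁−1), extended by
-- e_{r−1}^(n_{r−1}−1) when r ≥ 3, shows D(G) ≥ N + 2, so that block is shorter
-- than D(G) − 1.
module Submission where

open import Defs
open import Data.Nat using (ℕ; zero; suc; _+_; _*_; _∸_; _≤_; _<_; z≤n; s≤s; z<s; _%_; _/_; NonZero; >-nonZero)
open import Data.Nat.Properties
open import Algebra.Properties.CommutativeSemigroup +-commutativeSemigroup using () renaming (xy∙z≈xz∙y to +-right-comm)
open import Algebra.Properties.CommutativeSemigroup *-commutativeSemigroup using () renaming (xy∙z≈xz∙y to *-right-comm)
open import Data.Nat.DivMod using (m≡m%n+[m/n]*n; m%n<n; [m+kn]%n≡m%n; m<n⇒m%n≡m)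
open import Data.Nat.Divisibility using (_∣_; divides)
open import Data.Nat.ListAction using (sum)
open import Data.Fin using (Fin; toℕ; fromℕ; fromℕ<) renaming (zero to fzero; suc to fsuc)
import Data.Fin.Properties as Finₚ
open import Data.List using (List; []; _∷_; _++_; length; replicate; take; drop; map)
open import Data.List.Properties using (length-++; length-replicate; length-take; length-drop; take++drop≡id; take-take)
open import Data.List.Relation.Binary.Sublist.Propositional using (_⊆_; []; _∷ʳ_; _∷_; ⊆-trans)
open import Data.List.Relation.Binary.Sublist.Propositional.Properties using (All-resp-⊆; take-⊆; drop-⊆)
open import Data.List.Relation.Unary.All using (All; []; _∷_)
open import Data.List.Relation.Unary.Unique.Propositional using (Unique; []; _∷_)
open import Data.Product using (∃; ∃₂; _×_; _,_; proj₁; proj₂)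
open import Data.Bool using (if_then_else_)
open import Relation.Nullary using (¬_; yes; no; does; contradiction)
open import Function using (_∘_)
open import Relation.Binary.PropositionalEquality using (_≡_; refl; sym; trans; cong; cong₂; subst; _≢_; module ≡-Reasoning)
open import Function.Bundles using (Equivalence)

module _ {m : ℕ} where

  Cong-reflexive : ∀ {x y} → x ≡ y → Cong m x y
  Cong-reflexive refl = 0 , 0 , refl

  Cong-sym : ∀ {x y} → Cong m x y → Cong m y x
  Cong-sym (a , b , e) = b , a , sym e

  Cong-trans : ∀ {x y z} → Cong m x y → Cong m y z → Cong m x z
  Cong-trans {x} {y} {z} (a , b , x≡y) (c , d , y≡z) = a + c , b + d , (begin
    x + (a + c) * m        ≡⟨ cong (x +_) (*-distribʳ-+ m a c) ⟩
    x + (a * m + c * m)    ≡⟨ +-assoc x _ _ ⟨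
    (x + a * m) + c * m    ≡⟨ cong (_+ c * m) x≡y ⟩
    (y + b * m) + c * m    ≡⟨ +-right-comm y _ _ ⟩
    (y + c * m) + b * m    ≡⟨ cong (_+ b * m) y≡z ⟩
    (z + d * m) + b * m    ≡⟨ +-right-comm z _ _ ⟩
    (z + b * m) + d * m    ≡⟨ +-assoc z _ _ ⟩
    z + (b * m + d * m)    ≡⟨ cong (z +_) (*-distribʳ-+ m b d) ⟨
    z + (b + d) * m        ∎)
    where open ≡-Reasoning

  Cong-*ʳ : ∀ {x y} k → Cong m x y → Cong m (x * k) (y * k)
  Cong-*ʳ {x} {y} k (a , b , e) = a * k , b * k , (begin
    x * k + a * k * m    ≡⟨ cong (x * k +_) (*-right-comm a k m) ⟩
    x * k + a * m * k    ≡⟨ *-distribʳ-+ k x (a * m) ⟨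
    (x + a * m) * k      ≡⟨ cong (_* k) e ⟩
    (y + b * m) * k      ≡⟨ *-distribʳ-+ k y (b * m) ⟩
    y * k + b * m * k    ≡⟨ cong (y * k +_) (*-right-comm b m k) ⟩
    y * k + b * k * m    ∎)
    where open ≡-Reasoning

  Cong-cancelˡ : ∀ {p s} → Cong m p (p + s) → Cong m s 0
  Cong-cancelˡ {p} {s} (a , b , e) = b , a , sym (+-cancelˡ-≡ p _ _ (trans e (+-assoc p s (b * m))))

  Cong-∣ : ∀ {k x y} → k ∣ m → Cong m x y → Cong k x y
  Cong-∣ {k} {x} {y} (divides q refl) (a , b , e) =
    a * q , b * q , trans (cong (x +_) (*-assoc a q k)) (trans e (cong (y +_) (sym (*-assoc b q k))))

  module _ .{{_ : NonZero m}} where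

    Cong⇒%≡ : ∀ {x y} → Cong m x y → x % m ≡ y % m
    Cong⇒%≡ {x} {y} (a , b , e) = begin
      x % m            ≡⟨ [m+kn]%n≡m%n x a m ⟨
      (x + a * m) % m  ≡⟨ cong (_% m) e ⟩
      (y + b * m) % m  ≡⟨ [m+kn]%n≡m%n y b m ⟩
      y % m            ∎
      where open ≡-Reasoning

    %≡⇒Cong : ∀ {x y} → x % m ≡ y % m → Cong m x y
    %≡⇒Cong {x} {y} x%≡y% = y / m , x / m , (begin
      x + (y / m) * m                        ≡⟨ cong (_+ (y / m) * m) (m≡m%n+[m/n]*n x m) ⟩
      (x % m + (x / m) * m) + (y / m) * m    ≡⟨ cong (λ r → (r + (x / m) * m) + (y / m) * m) x%≡y% ⟩
      (y % m + (x / m) * m) + (y / m) * m    ≡⟨ +-right-comm (y % m) _ _ ⟩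
      (y % m + (y / m) * m) + (x / m) * m    ≡⟨ cong (_+ (x / m) * m) (m≡m%n+[m/n]*n y m) ⟨
      y + (x / m) * m                        ∎)
      where open ≡-Reasoning

  ¬Cong-0 : ∀ {v} → 0 < v → v < m → ¬ Cong m v 0
  ¬Cong-0 {v} 0<v v<m v≡0 = <⇒≢ 0<v (sym (begin
    v      ≡⟨ m<n⇒m%n≡m v<m ⟨
    v % m  ≡⟨ Cong⇒%≡ v≡0 ⟩
    0 % m  ≡⟨ m<n⇒m%n≡m 0<m ⟩
    0      ∎))
    where
    open ≡-Reasoning
    0<m : 0 < m
    0<m = ≤-<-trans z≤n v<m
    instance
      m-nonZero : NonZero m
      m-nonZero = >-nonZero 0<m

pigeonhole-Cong : ∀ N .{{_ : NonZero N}} (f : ℕ → ℕ) →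
                  ∃₂ λ i j → i < j × j ≤ N × Cong N (f i) (f j)
pigeonhole-Cong N f
  with i , j , i<j , fi≡fj ← Finₚ.pigeonhole (n<1+n N) (λ k → fromℕ< (m%n<n (f (toℕ k)) N))
  = toℕ i , toℕ j , i<j , Finₚ.toℕ≤pred[n] j , %≡⇒Cong (Finₚ.fromℕ<-injective _ _ _ _ fi≡fj)

module _ {r : ℕ} (F : InvFactors r) where
  open InvFactors F
  open Group F

  σ-++ : ∀ A B t → σ (A ++ B) t ≡ σ A t + σ B t
  σ-++ []      B t = refl
  σ-++ (x ∷ A) B t = trans (cong (x t +_) (σ-++ A B t)) (sym (+-assoc (x t) _ _))

  σ-replicate : ∀ k x t → σ (replicate k x) t ≡ k * x t
  σ-replicate zero    x t = refl
  σ-replicate (suc k) x t = cong (x t +_) (σ-replicate k x t)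

  σ-mono : ∀ {T Z} → T ⊆ Z → ∀ t → σ T t ≤ σ Z t
  σ-mono []         t = z≤n
  σ-mono (y ∷ʳ p)   t = m≤n⇒m≤o+n (y t) (σ-mono p t)
  σ-mono (refl ∷ p) t = +-monoʳ-≤ _ (σ-mono p t)

  HasPositiveCoord : Elem → Set
  HasPositiveCoord x = ∃ λ t → 0 < x t

  -- The first term of a nonempty subsequence makes some coordinate sum a
  -- natural number strictly between 0 and n t, hence nonzero modulo n t.
  bounded⇒zeroSumFree : ∀ {Z} → All HasPositiveCoord Z → (∀ t → σ Z t < n t) → ¬ HasNZS Z
  bounded⇒zeroSumFree Z⁺ σZ<n (x ∷ T , T⊆Z , _ , zs) with All-resp-⊆ T⊆Z Z⁺
  ... | (t , 0<xt) ∷ _ =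
    ¬Cong-0 (≤-trans 0<xt (m≤m+n (x t) (σ T t))) (≤-<-trans (σ-mono T⊆Z t) (σZ<n t)) (zs t)

  zeroSumFree⇒length<D : ∀ {d Z} → IsDavenport d → ¬ HasNZS Z → length Z < d
  zeroSumFree⇒length<D (davenport , _) Z-free = ≰⇒> (λ d≤|Z| → Z-free (davenport _ d≤|Z|))

  basis : Fin r → Elem
  basis i t = if does (i Finₚ.≟ t) then 1 else 0

  basis-diag : ∀ i → basis i i ≡ 1
  basis-diag i with i Finₚ.≟ i
  ... | yes _  = refl
  ... | no i≢i = contradiction refl i≢i

  basis-offDiag : ∀ {i t} → i ≢ t → basis i t ≡ 0
  basis-offDiag {i} {t} i≢t with i Finₚ.≟ t
  ... | yes i≡t = contradiction i≡t i≢t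
  ... | no _    = refl

  basisSeq : List (Fin r) → Seq
  basisSeq []       = []
  basisSeq (i ∷ is) = replicate (n i ∸ 1) (basis i) ++ basisSeq is

  length-basisSeq : ∀ is → length (basisSeq is) ≡ sum (map (λ i → n i ∸ 1) is)
  length-basisSeq []       = refl
  length-basisSeq (i ∷ is) =
    trans (length-++ (replicate (n i ∸ 1) (basis i))) (cong₂ _+_ (length-replicate (n i ∸ 1)) (length-basisSeq is))

  basisSeq-positive : ∀ is → All HasPositiveCoord (basisSeq is)
  basisSeq-positive []       = []
  basisSeq-positive (i ∷ is) = replicate-positive (n i ∸ 1)
    where
    replicate-positive : ∀ k → All HasPositiveCoord (replicate k (basis i) ++ basisSeq is)
    replicate-positive zero    = basisSeq-positive is
    replicate-positive (suc k) = (i , ≤-reflexive (sym (basis-diag i))) ∷ replicate-positive k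

  σ-basisSeq-∷ : ∀ i is t → σ (basisSeq (i ∷ is)) t ≡ (n i ∸ 1) * basis i t + σ (basisSeq is) t
  σ-basisSeq-∷ i is t =
    trans (σ-++ (replicate (n i ∸ 1) (basis i)) _ t) (cong (_+ σ (basisSeq is) t) (σ-replicate (n i ∸ 1) (basis i) t))

  σ-basisSeq-∉ : ∀ {t is} → All (t ≢_) is → σ (basisSeq is) t ≡ 0
  σ-basisSeq-∉ {is = []}     []           = refl
  σ-basisSeq-∉ {t} {i ∷ is} (t≢i ∷ t∉is) = begin
    σ (basisSeq (i ∷ is)) t                    ≡⟨ σ-basisSeq-∷ i is t ⟩
    (n i ∸ 1) * basis i t + σ (basisSeq is) t      ≡⟨ cong₂ (λ c s → (n i ∸ 1) * c + s) (basis-offDiag (t≢i ∘ sym)) (σ-basisSeq-∉ t∉is) ⟩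
    (n i ∸ 1) * 0 + 0                          ≡⟨ cong (_+ 0) (*-zeroʳ (n i ∸ 1)) ⟩
    0                                          ∎
    where open ≡-Reasoning

  σ-basisSeq-≤ : ∀ {is} → Unique is → ∀ t → σ (basisSeq is) t ≤ n t ∸ 1
  σ-basisSeq-≤ {[]}     []               t = z≤n
  σ-basisSeq-≤ {i ∷ is} (i∉is ∷ is-uniq) t with i Finₚ.≟ t
  ... | yes refl = ≤-reflexive (begin
    σ (basisSeq (i ∷ is)) i                    ≡⟨ σ-basisSeq-∷ i is i ⟩
    (n i ∸ 1) * basis i i + σ (basisSeq is) i      ≡⟨ cong₂ (λ c s → (n i ∸ 1) * c + s) (basis-diag i) (σ-basisSeq-∉ i∉is) ⟩
    (n i ∸ 1) * 1 + 0                          ≡⟨ trans (+-identityʳ _) (*-identityʳ _) ⟩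
    n i ∸ 1                                    ∎)
    where open ≡-Reasoning
  ... | no i≢t = begin
    σ (basisSeq (i ∷ is)) t                    ≡⟨ σ-basisSeq-∷ i is t ⟩
    (n i ∸ 1) * basis i t + σ (basisSeq is) t      ≡⟨ cong (λ c → (n i ∸ 1) * c + σ (basisSeq is) t) (basis-offDiag i≢t) ⟩
    (n i ∸ 1) * 0 + σ (basisSeq is) t          ≡⟨ cong (_+ σ (basisSeq is) t) (*-zeroʳ (n i ∸ 1)) ⟩
    σ (basisSeq is) t                          ≤⟨ σ-basisSeq-≤ is-uniq t ⟩
    n t ∸ 1                                    ∎
    where open ≤-Reasoning

  sum-pred-invFactors<D : ∀ {d is} → IsDavenport d → Unique is → sum (map (λ i → n i ∸ 1) is) < d
  sum-pred-invFactors<D {is = is} dav is-uniq =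
    subst (_< _) (length-basisSeq is) (zeroSumFree⇒length<D dav (bounded⇒zeroSumFree (basisSeq-positive is) σ<n))
    where
    σ<n : ∀ t → σ (basisSeq is) t < n t
    σ<n t = ≤-<-trans (σ-basisSeq-≤ is-uniq t) (∸-monoʳ-< {n t} {1} {0} z<s (<⇒≤ (n>1 t)))

  takeCoeffs : (S : Seq) → ℕ → Fin (length S) → ℕ
  takeCoeffs (x ∷ S) zero    j        = 0
  takeCoeffs (x ∷ S) (suc k) fzero    = 1
  takeCoeffs (x ∷ S) (suc k) (fsuc j) = takeCoeffs S k j

  lin-zero : ∀ S t → lin S (λ _ → 0) t ≡ 0
  lin-zero []      t = refl
  lin-zero (x ∷ S) t = lin-zero S t

  lin-takeCoeffs : ∀ S k t → lin S (takeCoeffs S k) t ≡ σ (take k S) t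
  lin-takeCoeffs []      zero    t = refl
  lin-takeCoeffs []      (suc k) t = refl
  lin-takeCoeffs (x ∷ S) zero    t = lin-zero S t
  lin-takeCoeffs (x ∷ S) (suc k) t = cong₂ _+_ (*-identityˡ (x t)) (lin-takeCoeffs S k t)

  σ-take-∈⟨⟩ : ∀ S k → σ (take k S) ∈⟨ S ⟩
  σ-take-∈⟨⟩ S k = takeCoeffs S k , λ t → Cong-reflexive (sym (lin-takeCoeffs S k t))

  singleGenerator : ∀ L → length L ≤ 1 → ∃ λ g → ∀ {x} → x ∈⟨ L ⟩ → ∃ λ c → x ≈ (c · g)
  singleGenerator []          _        = 0G , λ (_ , x≈0) → 0 , x≈0
  singleGenerator (g ∷ [])    _        = g , λ (c , x≈cg) → c fzero , λ t → Cong-trans (x≈cg t) (Cong-reflexive (+-identityʳ _))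
  singleGenerator (_ ∷ _ ∷ _) (s≤s ())

  ·-cong-mod : ∀ {N c c'} → (∀ t → n t ∣ N) → Cong N c c' → ∀ g → (c · g) ≈ (c' · g)
  ·-cong-mod n∣N c~c' g t = Cong-*ʳ (g t) (Cong-∣ (n∣N t) c~c')

  prefixSumsCollide : ∀ N .{{_ : NonZero N}} → (∀ t → n t ∣ N) → ∀ S g →
                      (∀ {x} → x ∈⟨ S ⟩ → ∃ λ c → x ≈ (c · g)) →
                      ∃₂ λ i j → i < j × j ≤ N × σ (take i S) ≈ σ (take j S)
  prefixSumsCollide N n∣N S g ⟨S⟩⊆⟨g⟩ =
    let i , j , i<j , j≤N , cᵢ~cⱼ = pigeonhole-Cong N (proj₁ ∘ multiplier)
    in i , j , i<j , j≤N , λ t →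
       Cong-trans (proj₂ (multiplier i) t) (Cong-trans (·-cong-mod n∣N cᵢ~cⱼ g t) (Cong-sym (proj₂ (multiplier j) t)))
    where
    multiplier : ∀ k → ∃ λ c → σ (take k S) ≈ (c · g)
    multiplier k = ⟨S⟩⊆⟨g⟩ (σ-take-∈⟨⟩ S k)

  σ-take-drop : ∀ S {i j} → i ≤ j → ∀ t → σ (take j S) t ≡ σ (take i S) t + σ (drop i (take j S)) t
  σ-take-drop S {i} {j} i≤j t = begin
    σ (take j S) t                                              ≡⟨ cong (λ X → σ X t) (take++drop≡id i (take j S)) ⟨
    σ (take i (take j S) ++ drop i (take j S)) t                ≡⟨ σ-++ (take i (take j S)) _ t ⟩
    σ (take i (take j S)) t + σ (drop i (take j S)) t           ≡⟨ cong (λ X → σ X t + σ (drop i (take j S)) t) take-i-take-j ⟩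
    σ (take i S) t + σ (drop i (take j S)) t                    ∎
    where
    open ≡-Reasoning
    take-i-take-j : take i (take j S) ≡ take i S
    take-i-take-j = trans (take-take i j S) (cong (λ k → take k S) (m≤n⇒m⊓n≡m i≤j))

  prefixSums≈⇒zeroSumBlock : ∀ S {i j} → i < j → j ≤ length S → σ (take i S) ≈ σ (take j S) →
                             ∃ λ T → T ⊆ S × length T ≡ j ∸ i × ZeroSum T
  prefixSums≈⇒zeroSumBlock S {i} {j} i<j j≤|S| prefix≈ =
    drop i (take j S) , ⊆-trans (drop-⊆ i (take j S)) (take-⊆ j S) , length-block ,
    λ t → Cong-cancelˡ (Cong-trans (prefix≈ t) (Cong-reflexive (σ-take-drop S (<⇒≤ i<j) t)))
    where
    length-block : length (drop i (take j S)) ≡ j ∸ i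
    length-block = trans (length-drop i (take j S))
                         (cong (_∸ i) (trans (length-take j S) (m≤n⇒m⊓n≡m j≤|S|)))

  cyclic⇒shortZeroSum : ∀ N .{{_ : NonZero N}} → (∀ t → n t ∣ N) → ∀ {S} g → N ≤ length S →
                        (∀ {x} → x ∈⟨ S ⟩ → ∃ λ c → x ≈ (c · g)) →
                        ∃ λ T → T ⊆ S × 1 ≤ length T × length T ≤ N × ZeroSum T
  cyclic⇒shortZeroSum N n∣N {S} g N≤|S| ⟨S⟩⊆⟨g⟩ =
    let i , j , i<j , j≤N , prefix≈ = prefixSumsCollide N n∣N S g ⟨S⟩⊆⟨g⟩
        T , T⊆S , |T|≡j∸i , zeroSum = prefixSums≈⇒zeroSumBlock S i<j (≤-trans j≤N N≤|S|) prefix≈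
    in T , T⊆S , subst (1 ≤_) (sym |T|≡j∸i) (m<n⇒0<n∸m i<j) ,
       subst (_≤ N) (sym |T|≡j∸i) (≤-trans (m∸n≤m j i) j≤N) , zeroSum

twoFactorsBound : ∀ {a b} → 3 ≤ a → 2 ≤ b → b + 2 ≤ suc ((a ∸ 1) + ((b ∸ 1) + 0))
twoFactorsBound {suc (suc (suc a))} {suc b} (s≤s (s≤s (s≤s _))) (s≤s _) = begin
  suc b + 2      ≡⟨ +-comm (suc b) 2 ⟩
  3 + b          ≡⟨ cong (3 +_) (+-identityʳ b) ⟨
  3 + (b + 0)    ≤⟨ +-monoʳ-≤ 3 (m≤n+m (b + 0) a) ⟩
  3 + (a + (b + 0)) ∎
  where open ≤-Reasoning

threeFactorsBound : ∀ {a b c} → 2 ≤ a → 2 ≤ b → 1 ≤ c → c + 2 ≤ suc ((a ∸ 1) + ((b ∸ 1) + ((c ∸ 1) + 0)))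
threeFactorsBound {suc (suc a)} {suc (suc b)} {suc c} (s≤s (s≤s _)) (s≤s (s≤s _)) (s≤s _) = begin
  suc c + 2                       ≡⟨ +-comm (suc c) 2 ⟩
  2 + suc c                       ≡⟨ cong (λ x → 2 + suc x) (+-identityʳ c) ⟨
  2 + suc (c + 0)                 ≤⟨ +-monoʳ-≤ 2 (≤-trans (s≤s (m≤n+m (c + 0) b)) (m≤n+m _ a)) ⟩
  2 + (a + suc (b + (c + 0)))     ∎
  where open ≤-Reasoning

exponent+2≤D : ∀ {k} (F : InvFactors (suc (suc k))) → ¬ IsC2⊕C2m F → ∀ {d} → Group.IsDavenport F d →
               InvFactors.n F (fromℕ (suc k)) + 2 ≤ d
exponent+2≤D {zero} F notC2⊕C2m dav =
  ≤-trans (twoFactorsBound n₀≥3 (n>1 (fsuc fzero))) (sum-pred-invFactors<D F dav (((λ ()) ∷ []) ∷ [] ∷ []))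
  where
  open InvFactors F
  n₀≥3 : 3 ≤ n fzero
  n₀≥3 = ≤∧≢⇒< (n>1 fzero) (λ 2≡n₀ → notC2⊕C2m (refl , fzero , refl , sym 2≡n₀))
exponent+2≤D {suc k} F _ dav =
  ≤-trans (threeFactorsBound (n>1 fzero) (n>1 (fsuc fzero)) (<⇒≤ (n>1 (fromℕ (suc (suc k))))))
          (sum-pred-invFactors<D F dav (((λ ()) ∷ (λ ()) ∷ []) ∷ ((λ ()) ∷ []) ∷ [] ∷ []))
  where open InvFactors F

mainTheorem6 : (r : ℕ) → (F : InvFactors r) → 2 ≤ r → ¬ IsC2⊕C2m F
    → (d : ℕ) → Group.IsDavenport F d
    → (S : Group.Seq F) → length S ≡ d + 1
    → (∀ T → T ⊆ S → 1 ≤ length T → Group.ZeroSum F T → d ∸ 1 ≤ length T)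
    → Group.RankAtLeast2 F S
mainTheorem6 (suc zero) F (s≤s ())
mainTheorem6 (suc (suc k)) F _ notC2⊕C2m d dav S |S|≡d+1 zeroSums-long (L , |L|≤1 , ⟨L⟩=⟨S⟩) =
  let g , ⟨L⟩⊆⟨g⟩ = singleGenerator F L |L|≤1
      T , T⊆S , 1≤|T| , |T|≤N , zeroSum =
        cyclic⇒shortZeroSum F N (λ t → chain t last (Finₚ.≤fromℕ t)) g N≤|S| (⟨L⟩⊆⟨g⟩ ∘ Equivalence.from (⟨L⟩=⟨S⟩ _))
  in <⇒≱ (≤-<-trans |T|≤N N<d∸1) (zeroSums-long T T⊆S 1≤|T| zeroSum)
  where
  open InvFactors F
  last : Fin (suc (suc k))
  last = fromℕ (suc k)
  N : ℕ
  N = n last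
  N+2≤d : N + 2 ≤ d
  N+2≤d = exponent+2≤D F notC2⊕C2m dav
  N≤|S| : N ≤ length S
  N≤|S| = subst (N ≤_) (sym |S|≡d+1) (≤-trans (m≤m+n N 2) (≤-trans N+2≤d (m≤m+n d 1)))
  N<d∸1 : N < d ∸ 1
  N<d∸1 = m+n≤o⇒m≤o∸n (suc N) (subst (_≤ d) (+-suc N 1) N+2≤d)
  instance
    N-nonZero : NonZero N
    N-nonZero = >-nonZero (<⇒≤ (n>1 last))
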